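{- For all $r,n\ge0$ there is a bijection $(w_0,u_1,\dots,u_h)\mapsto(w_0,l_1,\dots,l_m)$ from $U_n^*(r)$ onto $L_n^*(r)$ (preserving the first component $w_0$) such that (i) $l_1l_2\cdots l_m$ is a rearrangement of $u_1u_2\cdots u_h$, so that $\mathrm{tot}\,l_1+\cdots+\mathrm{tot}\,l_m=\mathrm{tot}\,u_1+\cdots+\mathrm{tot}\,u_h$; and (ii) $\mathrm{dec}\,l_1+\cdots+\mathrm{dec}\,l_m=\mathrm{dec}\,u_1+\cdots+\mathrm{dec}\,u_h$.
   Context: Words have nonnegative integer letters; $\lambda$ is length, $\mathrm{tot}$ the sum of letters, $\max$ the maximum letter. For $w=x_1\cdots x_n$, $i\in\{1,\dots,n-1\}$ is a decrease if $x_i\ge\cdots\ge x_j>x_{j+1}$ for some $i\le j\le n-1$; $\mathrm{dec}\,w$ counts them. A $U$-word is a word $x_1\cdots x_n$, $n\ge 2$, such that for some $1\le i\le n-1$: $x_1\ge\cdots\ge x_i>x_{i+1}$ and $x_{i+1}\le\cdots\le x_n<x_1$; its $\mathrm{rmin}$ is $x_{i+1}$. A Lyndon word is a nonempty word of length $1$ or lexicographically strictly greater than all its proper cyclic rotations. An $L$-word is a Lyndon word $x_1\cdots x_n$ of length $n\ge2$ such that whenever $x_1=x_i$ for some $2\le i\le n$, then $x_1=x_2=\cdots=x_i$. $\mathrm{NIW}(r)$ is the set of nonincreasing words over $\{0,\dots,r\}$. $U_n^*(r)$ is the set of sequences $(w_0,w_1,\dots,w_k)$, $k\ge0$, with $w_0\in\mathrm{NIW}(r)$,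 each $w_j$ ($j\ge1$) a $U$-word with letters $\le r$, $\lambda w_0+\cdots+\lambda w_k=n$, and $\mathrm{rmin}\,w_j<\max w_{j+1}$ for $1\le j\le k-1$. $L_n^*(r)$ is the set of sequences $(w_0,w_1,\dots,w_k)$ with $w_0\in\mathrm{NIW}(r)$, each $w_j$ ($j\ge 1$) an $L$-word with letters $\le r$, total length $n$, and $\max w_1\le\max w_2\le\cdots\le\max w_k$. -}

module Defs where

open import Data.Nat using (ℕ; zero; suc; _+_; _≤_; _<_; _≥_; _⊔_; _≤ᵇ_; _<ᵇ_)
open import Data.Bool using (Bool; true; false; _∧_; _∨_; if_then_else_)
open import Data.List using (List; []; _∷_; _++_; [_]; length; map; foldr; drop; take; concat)
open import Data.Nat.ListAction using (sum)
open import Data.List.Relation.Unary.All using (All)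
open import Data.List.Relation.Unary.Linked using (Linked)
open import Data.List.Relation.Binary.Lex.Core using (Lex-<)
open import Data.Product using (Σ; ∃; _×_; _,_)
open import Data.Sum using (_⊎_)
open import Relation.Binary.PropositionalEquality using (_≡_; _≢_)

Word : Set
Word = List ℕ

tot : Word → ℕ
tot = sum

-- max letter (0 for the empty word; only used on nonempty words)
maxL : Word → ℕ
maxL = foldr _⊔_ 0

lastOf : ℕ → Word → ℕ
lastOf x []       = x
lastOf x (y ∷ ys) = lastOf y ys

Nonincreasing : Word → Set
Nonincreasing = Linked _≥_

Nondecreasing : Word → Set
Nondecreasing = Linked _≤_

LettersLe : ℕ → Word → Set
LettersLe r = All (_≤ r)

-- decAt (x_i ∷ x_{i+1} ∷ …) : does there exist j ≥ i with x_i ≥ … ≥ x_j > x_{j+1}?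
-- (either j = i and x_i > x_{i+1}, or x_i ≥ x_{i+1} and such a j ≥ i+1 exists)
decAt : Word → Bool
decAt []            = false
decAt (x ∷ [])      = false
decAt (x ∷ y ∷ zs)  = (y <ᵇ x) ∨ ((y ≤ᵇ x) ∧ decAt (y ∷ zs))

dec : Word → ℕ
dec []       = 0
dec (x ∷ xs) = (if decAt (x ∷ xs) then 1 else 0) + dec xs

UWordWithRmin : Word → ℕ → Set
UWordWithRmin w m =
  Σ ℕ λ x₁ → Σ Word λ a → Σ Word λ b →
    (w ≡ (x₁ ∷ a) ++ (m ∷ b)) ×
    Nonincreasing (x₁ ∷ a) × (m < lastOf x₁ a) ×
    Nondecreasing (m ∷ b) × (lastOf m b < x₁)

UWord : Word → Set
UWord w = ∃ λ m → UWordWithRmin w m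

rotate : ℕ → Word → Word
rotate k w = drop k w ++ take k w

_<lex_ : Word → Word → Set
u <lex v = Lex-< _≡_ _<_ u v

Lyndon : Word → Set
Lyndon w = (w ≢ []) ×
  (length w ≡ 1 ⊎ (∀ k → 1 ≤ k → k < length w → rotate k w <lex w))

LWord : Word → Set
LWord w = Lyndon w × (2 ≤ length w) ×
  (∀ x p s → w ≡ x ∷ (p ++ (x ∷ s)) → All (_≡ x) p)

Seq : Set
Seq = Word × List Word

totalLength : Seq → ℕ
totalLength (w₀ , ws) = length w₀ + sum (map length ws)

InUStar : ℕ → ℕ → Seq → Set
InUStar n r (w₀ , us) =
  (Nonincreasing w₀ × LettersLe r w₀) ×
  All (λ u → UWord u × LettersLe r u) us ×
  (totalLength (w₀ , us) ≡ n) ×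
  Linked (λ u u' → ∀ m → UWordWithRmin u m → m < maxL u') us

InLStar : ℕ → ℕ → Seq → Set
InLStar n r (w₀ , ls) =
  (Nonincreasing w₀ × LettersLe r w₀) ×
  All (λ l → LWord l × LettersLe r l) ls ×
  (totalLength (w₀ , ls) ≡ n) ×
  Linked (λ l l' → maxL l ≤ maxL l') ls

-- A U-word u is a nonincreasing run D = x ⋯ followed by a nondecreasing word e
-- whose letters lie below x; its decreases are exactly the positions of D.
-- L-words are exactly the words x x^j c w with all of c w below x (LShape).
-- The U-words are turned into L-words from right to left: the L-words already
-- built from the later U-words are kept sorted by their first letter, and those
-- whose first letter is below x are merged into e as blocks, each inserted just
-- before the first letter of e that is at least its head.  D followed by this
-- merged word is again an L-word.  Blocks are only inserted at rises, so the
-- decreases of the new L-word are those of D plus those of the blocks, while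
-- letters are merely rearranged.  The map is inverted by reading the blocks back
-- off the merged word: a position there starts a block exactly when it is a
-- decrease, and the block then consists of the run of its first letter followed
-- by the letters below it.

module Submission where

open import Data.Bool using (true; false; _∧_; _∨_; if_then_else_)
open import Data.List using (List; []; _∷_; _++_; [_]; length; replicate; drop; take; map; concat; span)
open import Data.List.Properties
  using (++-assoc; ++-identityʳ; length-++; length-++-≤ʳ; map-++; concat-++; take++drop≡id; ∷-injectiveˡ; ∷-injectiveʳ)
open import Data.List.Membership.Propositional using (_∈_)
open import Data.List.Membership.Propositional.Properties using (∈-∃++)
open import Data.List.Relation.Binary.Lex.Core using (this; next)
import Data.List.Relation.Binary.Lex.Strict as LexStrict
open import Data.List.Relation.Binary.Permutation.Propositional
  using (_↭_; ↭-refl; ↭-reflexive; ↭-sym; ↭-trans; prep; module PermutationReasoning)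
open import Data.List.Relation.Binary.Permutation.Propositional.Properties
  using (++⁺ˡ; ++⁺ʳ; shifts; ↭-length; All-resp-↭)
import Data.List.Relation.Binary.Pointwise as Pointwise
open import Data.List.Relation.Unary.All as All using (All; []; _∷_)
import Data.List.Relation.Unary.All.Properties as All
open import Data.List.Relation.Unary.Linked as Linked using (Linked; []; [-]; _∷_)
open import Data.List.Relation.Unary.Linked.Properties using (Linked⇒All)
open import Data.Nat using (ℕ; zero; suc; _+_; _≤_; _<_; _≤ᵇ_; z≤n; s≤s; _∸_)
open import Data.Nat.ListAction using (sum)
open import Data.Nat.ListAction.Properties using (sum-++; sum-↭)
open import Data.Nat.Properties
open import Data.Product using (Σ; _×_; _,_; proj₁; proj₂; map₁; map₂)
open import Data.Sum using (_⊎_; inj₁; inj₂)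
open import Data.Unit using (⊤; tt)
open import Function using (_on_; _∘_; _⇔_; mk⇔; Equivalence)
open import Relation.Binary.Definitions using (tri<; tri≈; tri>)
open import Relation.Binary.PropositionalEquality
  using (_≡_; _≢_; refl; sym; trans; cong; cong₂; subst; subst₂; module ≡-Reasoning)
open import Relation.Nullary using (¬_; yes; no; does; contradiction)
open import Relation.Nullary.Decidable using (dec-true; dec-false)
open import Relation.Unary using (Decidable)

open import Defs

-- Decreases

decAt-descent : ∀ {x y} zs → y < x → decAt (x ∷ y ∷ zs) ≡ true
decAt-descent {x} {y} zs y<x = cong (_∨ ((y ≤ᵇ x) ∧ decAt (y ∷ zs))) (dec-true (y <? x) y<x)

decAt-ascent : ∀ {x y} zs → x < y → decAt (x ∷ y ∷ zs) ≡ false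
decAt-ascent {x} {y} zs x<y =
  cong₂ (λ a b → a ∨ (b ∧ decAt (y ∷ zs))) (dec-false (y <? x) (<⇒≯ x<y)) (dec-false (y ≤? x) (<⇒≱ x<y))

decAt-plateau : ∀ x zs → decAt (x ∷ x ∷ zs) ≡ decAt (x ∷ zs)
decAt-plateau x zs =
  cong₂ (λ a b → a ∨ (b ∧ decAt (x ∷ zs))) (dec-false (x <? x) (n≮n x)) (dec-true (x ≤? x) ≤-refl)

decAt-true⇒≥ : ∀ x y zs → decAt (x ∷ y ∷ zs) ≡ true → y ≤ x
decAt-true⇒≥ x y zs e with <-cmp y x
... | tri< y<x _ _ = <⇒≤ y<x
... | tri≈ _ y≡x _ = ≤-reflexive y≡x
... | tri> _ _ x<y with trans (sym e) (decAt-ascent zs x<y)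
...   | ()

decAt-false⇒≤ : ∀ x y zs → decAt (x ∷ y ∷ zs) ≡ false → x ≤ y
decAt-false⇒≤ x y zs e with <-cmp y x
... | tri< y<x _ _ with trans (sym (decAt-descent zs y<x)) e
...   | ()
decAt-false⇒≤ x y zs e | tri≈ _ y≡x _ = ≤-reflexive (sym y≡x)
decAt-false⇒≤ x y zs e | tri> _ _ x<y = <⇒≤ x<y

decAt-true-false⇒> : ∀ x y zs → decAt (x ∷ y ∷ zs) ≡ true → decAt (y ∷ zs) ≡ false → y < x
decAt-true-false⇒> x y zs e f with <-cmp y x
... | tri< y<x _ _ = y<x
... | tri≈ _ refl _ with trans (sym e) (trans (decAt-plateau y zs) f)
...   | ()
decAt-true-false⇒> x y zs e f | tri> _ _ x<y with trans (sym e) (decAt-ascent zs x<y)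
...   | ()

decAt-false-true⇒< : ∀ x y zs → decAt (x ∷ y ∷ zs) ≡ false → decAt (y ∷ zs) ≡ true → x < y
decAt-false-true⇒< x y zs f t with <-cmp x y
... | tri< x<y _ _ = x<y
... | tri≈ _ refl _ with trans (sym t) (trans (sym (decAt-plateau x zs)) f)
...   | ()
decAt-false-true⇒< x y zs f t | tri> _ _ y<x with trans (sym (decAt-descent zs y<x)) f
...   | ()

decAt-nondecreasing : ∀ x zs → Nondecreasing (x ∷ zs) → decAt (x ∷ zs) ≡ false
decAt-nondecreasing x [] _ = refl
decAt-nondecreasing x (y ∷ zs) (x≤y ∷ ys↑) with m≤n⇒m<n∨m≡n x≤y
... | inj₁ x<y = decAt-ascent zs x<y
... | inj₂ refl = trans (decAt-plateau x zs) (decAt-nondecreasing x zs ys↑)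

dec-nondecreasing : ∀ w → Nondecreasing w → dec w ≡ 0
dec-nondecreasing [] _ = refl
dec-nondecreasing (x ∷ []) _ = refl
dec-nondecreasing (x ∷ y ∷ zs) w↑@(_ ∷ ys↑)
  rewrite decAt-nondecreasing x (y ∷ zs) w↑ = dec-nondecreasing (y ∷ zs) ys↑

HeadAll : ∀ {A : Set} → (A → Set) → List A → Set
HeadAll Q []      = ⊤
HeadAll Q (c ∷ _) = Q c

HeadAll-map : ∀ {A : Set} {Q Q' : A → Set} xs → (∀ {c} → Q c → Q' c) → HeadAll Q xs → HeadAll Q' xs
HeadAll-map []      f _  = tt
HeadAll-map (_ ∷ _) f qc = f qc

_<Head_ : ℕ → Word → Set
b <Head r = HeadAll (b <_) r

_≤Head_ : ℕ → Word → Set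
b ≤Head r = HeadAll (b ≤_) r

Rise : Word → Word → Set
Rise []       r = ⊤
Rise (x ∷ xs) r = lastOf x xs <Head r

decAt-++-rise : ∀ x xs r → Rise (x ∷ xs) r → decAt ((x ∷ xs) ++ r) ≡ decAt (x ∷ xs)
decAt-++-rise x []       []      _   = refl
decAt-++-rise x []       (c ∷ z) x<c = decAt-ascent z x<c
decAt-++-rise x (y ∷ ys) r       p   rewrite decAt-++-rise y ys r p = refl

Rise-∷⁻ : ∀ {x} xs r → Rise (x ∷ xs) r → Rise xs r
Rise-∷⁻ []       r _ = tt
Rise-∷⁻ (y ∷ ys) r p = p

dec-++-rise : ∀ s r → Rise s r → dec (s ++ r) ≡ dec s + dec r
dec-++-rise []       r _ = refl
dec-++-rise (x ∷ xs) r p rewrite decAt-++-rise x xs r p | dec-++-rise xs r (Rise-∷⁻ xs r p) =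
  sym (+-assoc _ (dec xs) (dec r))

-- Descending prefixes

descentSplit : Word → Word × Word
descentSplit []       = [] , []
descentSplit (x ∷ xs) = if decAt (x ∷ xs) then map₁ (x ∷_) (descentSplit xs) else ([] , x ∷ xs)

descentSplit-++ : ∀ w → proj₁ (descentSplit w) ++ proj₂ (descentSplit w) ≡ w
descentSplit-++ [] = refl
descentSplit-++ (x ∷ xs) with decAt (x ∷ xs)
... | true  = cong (x ∷_) (descentSplit-++ xs)
... | false = refl

decAt-descendingRun : ∀ d ds c z → Nonincreasing (d ∷ ds) → c < lastOf d ds →
                      decAt ((d ∷ ds) ++ c ∷ z) ≡ true
decAt-descendingRun d []        c z _            c<d = decAt-descent z c<d
decAt-descendingRun d (d' ∷ ds) c z (d'≤d ∷ ds↓) c<l with m≤n⇒m<n∨m≡n d'≤d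
... | inj₁ d'<d = decAt-descent (ds ++ c ∷ z) d'<d
... | inj₂ refl = trans (decAt-plateau d (ds ++ c ∷ z)) (decAt-descendingRun d ds c z ds↓ c<l)

descentSplit-descendingRun : ∀ d ds c z → Nonincreasing (d ∷ ds) → c < lastOf d ds →
  decAt (c ∷ z) ≡ false → descentSplit ((d ∷ ds) ++ c ∷ z) ≡ (d ∷ ds , c ∷ z)
descentSplit-descendingRun d [] c z ↓ c<l f rewrite decAt-descendingRun d [] c z ↓ c<l | f = refl
descentSplit-descendingRun d (d' ∷ ds) c z ↓@(_ ∷ ds↓) c<l f
  rewrite decAt-descendingRun d (d' ∷ ds) c z ↓ c<l | descentSplit-descendingRun d' ds c z ds↓ c<l f = refl

dec-descendingRun : ∀ d ds c z → Nonincreasing (d ∷ ds) → c < lastOf d ds →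
                    dec ((d ∷ ds) ++ c ∷ z) ≡ length (d ∷ ds) + dec (c ∷ z)
dec-descendingRun d [] c z ↓ c<l rewrite decAt-descendingRun d [] c z ↓ c<l = refl
dec-descendingRun d (d' ∷ ds) c z ↓@(_ ∷ ds↓) c<l
  rewrite decAt-descendingRun d (d' ∷ ds) c z ↓ c<l | dec-descendingRun d' ds c z ds↓ c<l = refl

DescentSplitShape : ℕ → Word → Set
DescentSplitShape x xs = Σ Word λ ds → Σ ℕ λ c → Σ Word λ z →
  (descentSplit (x ∷ xs) ≡ (x ∷ ds , c ∷ z)) × Nonincreasing (x ∷ ds) × (c < lastOf x ds) ×
  (decAt (c ∷ z) ≡ false)

descentSplit-∷-true : ∀ x xs → decAt (x ∷ xs) ≡ true → descentSplit (x ∷ xs) ≡ map₁ (x ∷_) (descentSplit xs)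
descentSplit-∷-true x xs e rewrite e = refl

descentSplit-shape : ∀ x xs → decAt (x ∷ xs) ≡ true → DescentSplitShape x xs
descentSplit-shape x [] ()
descentSplit-shape x (y ∷ ys) e
  with decAt-true⇒≥ x y ys e | decAt-true-false⇒> x y ys e | descentSplit-∷-true x (y ∷ ys) e
... | y≤x | stop⇒y<x | split-eq with decAt (y ∷ ys) in f
... | false = [] , y , ys , split-eq , [-] , stop⇒y<x refl , f
... | true with descentSplit-shape y ys f
...   | ds , c , z , eq , ↓ , c<l , g =
  y ∷ ds , c , z , trans split-eq (cong (map₁ (x ∷_)) (trans (sym (descentSplit-∷-true y ys f)) eq)) ,
  y≤x ∷ ↓ , c<l , g

-- L-shapes and merging

-- 0 on the empty word; only applied to nonempty words.
hd : Word → ℕ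
hd []      = 0
hd (x ∷ _) = x

-- Normal form of L-words (LShape⇒LWord, LWord⇒LShape).
data LShape : Word → Set where
  lshape : ∀ {x} j c w → All (_< x) (c ∷ w) → LShape (x ∷ replicate j x ++ c ∷ w)

HeadSorted : List Word → Set
HeadSorted = Linked (_≤_ on hd)

HeadSorted⇒All≥ : ∀ {b t T} → b ≤ hd t → HeadSorted (t ∷ T) → All (λ s → b ≤ hd s) (t ∷ T)
HeadSorted⇒All≥ b≤t [-]        = b≤t ∷ []
HeadSorted⇒All≥ b≤t (t≤t' ∷ s) = b≤t ∷ HeadSorted⇒All≥ (≤-trans b≤t t≤t') s

HeadSorted-head : ∀ {t T} → HeadSorted (t ∷ T) → All (λ s → hd t ≤ hd s) T
HeadSorted-head [-]        = []
HeadSorted-head (t≤t' ∷ s) = HeadSorted⇒All≥ t≤t' s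

HeadSorted-∷ : ∀ {t T} → All (λ s → hd t ≤ hd s) T → HeadSorted T → HeadSorted (t ∷ T)
HeadSorted-∷ []          _ = [-]
HeadSorted-∷ (t≤t' ∷ _) s = t≤t' ∷ s

lastOf-++ : ∀ x (p : Word) c w → lastOf x (p ++ c ∷ w) ≡ lastOf c w
lastOf-++ x []      c w = refl
lastOf-++ x (y ∷ p) c w = lastOf-++ y p c w

All-lastOf : ∀ {P : ℕ → Set} c w → All P (c ∷ w) → P (lastOf c w)
All-lastOf c []      (pc ∷ _)  = pc
All-lastOf c (d ∷ w) (_ ∷ pw) = All-lastOf d w pw

LShape-rise : ∀ {t} r → LShape t → hd t ≤Head r → Rise t r
LShape-rise r (lshape {x} j c w c∷w<x) x≤r =
  subst (_<Head r) (sym (lastOf-++ x (replicate j x) c w)) (HeadAll-map r (<-≤-trans (All-lastOf c w c∷w<x)) x≤r)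

-- A block t is only inserted before a letter c ≥ hd t, so every junction is a rise.
merge : Word → List Word → Word
merge []      T       = concat T
merge (c ∷ e) []      = c ∷ e
merge (c ∷ e) (t ∷ T) = if hd t ≤ᵇ c then t ++ merge (c ∷ e) T else c ∷ merge e (t ∷ T)

merge-block : ∀ c e t T → hd t ≤ c → merge (c ∷ e) (t ∷ T) ≡ t ++ merge (c ∷ e) T
merge-block c e t T t≤c rewrite dec-true (hd t ≤? c) t≤c = refl

merge-letter : ∀ c e t T → c < hd t → merge (c ∷ e) (t ∷ T) ≡ c ∷ merge e (t ∷ T)
merge-letter c e t T c<t rewrite dec-false (hd t ≤? c) (<⇒≱ c<t) = refl

merge-[] : ∀ e → merge e [] ≡ e
merge-[] []      = refl
merge-[] (c ∷ e) = refl

merge-≤Head : ∀ b e T → b ≤Head e → All (λ t → b ≤ hd t) T → All LShape T → b ≤Head merge e T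
merge-≤Head b []      []      _   _          _                     = tt
merge-≤Head b []      (t ∷ T) _   (b≤t ∷ _) (lshape _ _ _ _ ∷ _) = b≤t
merge-≤Head b (c ∷ e) []      b≤c _          _                     = b≤c
merge-≤Head b (c ∷ e) (t ∷ T) b≤c (b≤t ∷ _) (lshape _ _ _ _ ∷ _) with hd t ≤? c
... | yes t≤c rewrite merge-block c e t T t≤c = b≤t
... | no  t≰c rewrite merge-letter c e t T (≰⇒> t≰c) = b≤c

decAt-merge : ∀ c e T → Nondecreasing (c ∷ e) → All (λ t → c < hd t) T → All LShape T →
              decAt (c ∷ merge e T) ≡ false
decAt-merge c [] [] _ _ _ = refl
decAt-merge c [] (t ∷ T) _ (c<t ∷ _) (lshape j c' w _ ∷ _) = decAt-ascent ((replicate j _ ++ c' ∷ w) ++ concat T) c<t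
decAt-merge c (c' ∷ e) [] e↑ _ _ = decAt-nondecreasing c (c' ∷ e) e↑
decAt-merge c (c' ∷ e) (t ∷ T) (c≤c' ∷ e↑) c<T@(c<t ∷ _) T⊢@(lshape j d w _ ∷ _) with hd t ≤? c'
... | yes t≤c' rewrite merge-block c' e t T t≤c' =
  decAt-ascent ((replicate j _ ++ d ∷ w) ++ merge (c' ∷ e) T) c<t
... | no  t≰c' rewrite merge-letter c' e t T (≰⇒> t≰c') with m≤n⇒m<n∨m≡n c≤c'
...   | inj₁ c<c' = decAt-ascent (merge e (t ∷ T)) c<c'
...   | inj₂ refl = trans (decAt-plateau c (merge e (t ∷ T))) (decAt-merge c e (t ∷ T) e↑ c<T T⊢)

-- dec-merge is an outer induction on e around an inner one on the blocks: the termination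
-- checker does not see the lexicographic descent through the with-abstractions.
DecMergeFrom : Word → Set
DecMergeFrom e = ∀ T → Nondecreasing e → HeadSorted T → All LShape T → dec (merge e T) ≡ sum (map dec T)

dec-concat : DecMergeFrom []
dec-concat [] _ _ _ = refl
dec-concat (t ∷ T) e↑ T↑ (t⊢ ∷ T⊢)
  rewrite dec-++-rise t (concat T) (LShape-rise (concat T) t⊢ (merge-≤Head (hd t) [] T tt (HeadSorted-head T↑) T⊢))
  = cong (dec t +_) (dec-concat T e↑ (Linked.tail T↑) T⊢)

dec-merge-∷ : ∀ c e → DecMergeFrom e → DecMergeFrom (c ∷ e)
dec-merge-∷ c e ih [] e↑ _ _ = dec-nondecreasing (c ∷ e) e↑
dec-merge-∷ c e ih (t ∷ T) e↑ T↑ T⊢@(t⊢ ∷ T⊢') with hd t ≤? c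
... | yes t≤c
  rewrite merge-block c e t T t≤c
        | dec-++-rise t (merge (c ∷ e) T)
            (LShape-rise (merge (c ∷ e) T) t⊢ (merge-≤Head (hd t) (c ∷ e) T t≤c (HeadSorted-head T↑) T⊢'))
  = cong (dec t +_) (dec-merge-∷ c e ih T e↑ (Linked.tail T↑) T⊢')
... | no t≰c
  rewrite merge-letter c e t T (≰⇒> t≰c)
        | decAt-merge c e (t ∷ T) e↑ (HeadSorted⇒All≥ (≰⇒> t≰c) T↑) T⊢
  = ih (t ∷ T) (Linked.tail e↑) T↑ T⊢

dec-merge : ∀ e → DecMergeFrom e
dec-merge []      = dec-concat
dec-merge (c ∷ e) = dec-merge-∷ c e (dec-merge e)

merge-↭-∷ : ∀ c e → (∀ T → merge e T ↭ e ++ concat T) → ∀ T → merge (c ∷ e) T ↭ (c ∷ e) ++ concat T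
merge-↭-∷ c e ih []      = ↭-reflexive (sym (++-identityʳ (c ∷ e)))
merge-↭-∷ c e ih (t ∷ T) with hd t ≤? c
... | yes t≤c rewrite merge-block c e t T t≤c = ↭-trans (++⁺ˡ t (merge-↭-∷ c e ih T)) (shifts t (c ∷ e))
... | no  t≰c rewrite merge-letter c e t T (≰⇒> t≰c) = prep c (ih (t ∷ T))

merge-↭ : ∀ e T → merge e T ↭ e ++ concat T
merge-↭ []      T = ↭-refl
merge-↭ (c ∷ e) T = merge-↭-∷ c e (merge-↭ e) T

-- Unmerging

span-++ : ∀ {A : Set} {P : A → Set} (P? : Decidable P) xs ys → All P xs → HeadAll (¬_ ∘ P) ys →
          span P? (xs ++ ys) ≡ (xs , ys)
span-++ P? []       []       _          _   = refl
span-++ P? []       (y ∷ ys) _          ¬Py rewrite dec-false (P? y) ¬Py = refl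
span-++ P? (x ∷ xs) ys       (Px ∷ Pxs) ¬P  rewrite dec-true (P? x) Px | span-++ P? xs ys Pxs ¬P = refl

span-spec : ∀ {A : Set} {P : A → Set} (P? : Decidable P) zs → let (xs , ys) = span P? zs in
            All P xs × HeadAll (¬_ ∘ P) ys × xs ++ ys ≡ zs
span-spec P? [] = [] , tt , refl
span-spec P? (z ∷ zs) with P? z
... | yes Pz = let (Pxs , ¬P , eq) = span-spec P? zs in Pz ∷ Pxs , ¬P , cong (z ∷_) eq
... | no ¬Pz = [] , ¬Pz , refl

-- Splits the word following the head y of a block into the rest of the block (its run of y's,
-- then its letters below y) and the remainder.
blockBody : ℕ → Word → Word × Word
blockBody y []      = [] , []
blockBody y (c ∷ z) = if does (c ≟ y) then map₁ (c ∷_) (blockBody y z) else span (_<? y) (c ∷ z)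

blockBody-++ : ∀ y j c w r → All (_< y) (c ∷ w) → y ≤Head r →
               blockBody y ((replicate j y ++ c ∷ w) ++ r) ≡ (replicate j y ++ c ∷ w , r)
blockBody-++ y zero    c w r c∷w<y y≤r
  rewrite dec-false (c ≟ y) (<⇒≢ (All.head c∷w<y)) = span-++ (_<? y) (c ∷ w) r c∷w<y (HeadAll-map r ≤⇒≯ y≤r)
blockBody-++ y (suc j) c w r c∷w<y y≤r
  rewrite dec-true (y ≟ y) refl | blockBody-++ y j c w r c∷w<y y≤r = refl

BlockSplit : ℕ → Word → Set
BlockSplit y z = Σ ℕ λ j → Σ ℕ λ c → Σ Word λ w → Σ Word λ r →
  (blockBody y z ≡ (replicate j y ++ c ∷ w , r)) × All (_< y) (c ∷ w) × y ≤Head r ×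
  ((replicate j y ++ c ∷ w) ++ r ≡ z)

blockBody-split : ∀ y z → decAt (y ∷ z) ≡ true → BlockSplit y z
blockBody-split y [] ()
blockBody-split y (c ∷ z) e with <-cmp c y
... | tri< c<y _ _ rewrite dec-false (c ≟ y) (<⇒≢ c<y) | dec-true (c <? y) c<y with span-spec (_<? y) z
...   | w<y , y≰r , eq =
  0 , c , _ , _ , refl , c<y ∷ w<y , HeadAll-map (proj₂ (span (_<? y) z)) ≮⇒≥ y≰r , cong (c ∷_) eq
blockBody-split y (c ∷ z) e | tri≈ _ refl _ rewrite dec-true (c ≟ c) refl
  with blockBody-split c z (trans (sym (decAt-plateau c z)) e)
...   | j , c' , w , r , eq , c'∷w<c , c≤r , eq' rewrite eq =
  suc j , c' , w , r , refl , c'∷w<c , c≤r , cong (c ∷_) eq'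
blockBody-split y (c ∷ z) e | tri> _ _ y<c with trans (sym e) (decAt-ascent z y<c)
...   | ()

decAt-plateauThenDescent : ∀ x j c w → c < x → decAt (x ∷ replicate j x ++ c ∷ w) ≡ true
decAt-plateauThenDescent x zero    c w c<x = decAt-descent w c<x
decAt-plateauThenDescent x (suc j) c w c<x =
  trans (decAt-plateau x (replicate j x ++ c ∷ w)) (decAt-plateauThenDescent x j c w c<x)

decAt-LShape-++ : ∀ {t} r → LShape t → decAt (t ++ r) ≡ true
decAt-LShape-++ r (lshape {x} j c w c∷w<x) rewrite ++-assoc (replicate j x) (c ∷ w) r =
  decAt-plateauThenDescent x j c (w ++ r) (All.head c∷w<x)

-- The fuel only ensures termination; unmerge k z is the intended value once length z ≤ k.
unmerge : ℕ → Word → Word × List Word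
unmerge zero    z       = z , []
unmerge (suc k) []      = [] , []
unmerge (suc k) (c ∷ z) =
  if decAt (c ∷ z)
  then map₂ ((c ∷ proj₁ (blockBody c z)) ∷_) (unmerge k (proj₂ (blockBody c z)))
  else map₁ (c ∷_) (unmerge k z)

unmerge-block : ∀ k c z b r → decAt (c ∷ z) ≡ true → blockBody c z ≡ (b , r) →
                unmerge (suc k) (c ∷ z) ≡ map₂ ((c ∷ b) ∷_) (unmerge k r)
unmerge-block k c z b r e eq rewrite e | eq = refl

unmerge-letter : ∀ k c z → decAt (c ∷ z) ≡ false → unmerge (suc k) (c ∷ z) ≡ map₁ (c ∷_) (unmerge k z)
unmerge-letter k c z e rewrite e = refl

unmerge-LShape-++ : ∀ k {t} r → LShape t → hd t ≤Head r → unmerge (suc k) (t ++ r) ≡ map₂ (t ∷_) (unmerge k r)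
unmerge-LShape-++ k r t⊢@(lshape {x} j c w c∷w<x) x≤r =
  unmerge-block k x _ _ r (decAt-LShape-++ r t⊢) (blockBody-++ x j c w r c∷w<x x≤r)

fuel-∷-++ : ∀ {k} x (s r : Word) → length ((x ∷ s) ++ r) ≤ suc k → length r ≤ k
fuel-∷-++ x s r (s≤s l) = ≤-trans (length-++-≤ʳ r {s}) l

fuel-LShape-++ : ∀ {k t} r → LShape t → length (t ++ r) ≤ suc k → length r ≤ k
fuel-LShape-++ r (lshape {x} j c w _) = fuel-∷-++ x (replicate j x ++ c ∷ w) r

fuel-++ : ∀ {k} (s r : Word) {z} → s ++ r ≡ z → length z ≤ k → length r ≤ k
fuel-++ s r refl l = ≤-trans (length-++-≤ʳ r {s}) l

merge-length : ∀ e T → length (merge e T) ≡ length e + length (concat T)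
merge-length e T = trans (↭-length (merge-↭ e T)) (length-++ e)

unmerge-merge : ∀ k e T → Nondecreasing e → HeadSorted T → All LShape T → length (merge e T) ≤ k →
                unmerge k (merge e T) ≡ (e , T)
unmerge-merge zero [] [] _ _ _ _ = refl
unmerge-merge zero [] (_ ∷ _) _ _ (lshape _ _ _ _ ∷ _) ()
unmerge-merge zero (c ∷ e) T _ _ _ l with subst (_≤ 0) (merge-length (c ∷ e) T) l
... | ()
unmerge-merge (suc k) [] [] _ _ _ _ = refl
unmerge-merge (suc k) [] (t ∷ T) e↑ T↑ (t⊢ ∷ T⊢) l =
  trans (unmerge-LShape-++ k (concat T) t⊢ (merge-≤Head (hd t) [] T tt (HeadSorted-head T↑) T⊢))
        (cong (map₂ (t ∷_)) (unmerge-merge k [] T e↑ (Linked.tail T↑) T⊢ (fuel-LShape-++ (concat T) t⊢ l)))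
unmerge-merge (suc k) (c ∷ e) [] e↑ _ _ (s≤s l) =
  trans (unmerge-letter k c e (decAt-nondecreasing c e e↑))
        (cong (map₁ (c ∷_)) (subst (λ z → unmerge k z ≡ (e , [])) (merge-[] e)
          (unmerge-merge k e [] (Linked.tail e↑) [] [] (subst (_≤ k) (cong length (sym (merge-[] e))) l))))
unmerge-merge (suc k) (c ∷ e) (t ∷ T) e↑ T↑ T⊢@(t⊢ ∷ T⊢') l with hd t ≤? c
... | yes t≤c rewrite merge-block c e t T t≤c =
  trans (unmerge-LShape-++ k (merge (c ∷ e) T) t⊢ (merge-≤Head (hd t) (c ∷ e) T t≤c (HeadSorted-head T↑) T⊢'))
        (cong (map₂ (t ∷_))
          (unmerge-merge k (c ∷ e) T e↑ (Linked.tail T↑) T⊢' (fuel-LShape-++ (merge (c ∷ e) T) t⊢ l)))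
... | no t≰c rewrite merge-letter c e t T (≰⇒> t≰c) with l
...   | s≤s l' =
  trans (unmerge-letter k c _ (decAt-merge c e (t ∷ T) e↑ (HeadSorted⇒All≥ (≰⇒> t≰c) T↑) T⊢))
        (cong (map₁ (c ∷_)) (unmerge-merge k e (t ∷ T) (Linked.tail e↑) T↑ T⊢ l'))

decAt-false⇒≤Head : ∀ c z → decAt (c ∷ z) ≡ false → c ≤Head z
decAt-false⇒≤Head c []       _ = tt
decAt-false⇒≤Head c (c' ∷ z) f = decAt-false⇒≤ c c' z f

unmerge-≥ : ∀ k z b → length z ≤ k → b ≤Head z →
            b ≤Head proj₁ (unmerge k z) × All (λ t → b ≤ hd t) (proj₂ (unmerge k z))
unmerge-≥ zero    z       b _       b≤z = b≤z , []
unmerge-≥ (suc k) []      b _       _   = tt , []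
unmerge-≥ (suc k) (c ∷ z) b (s≤s l) b≤c with decAt (c ∷ z) in e
... | false = b≤c , All.map (≤-trans b≤c) (proj₂ (unmerge-≥ k z c l (decAt-false⇒≤Head c z e)))
... | true with blockBody-split c z e
...   | j , c' , w , r , eq , _ , c≤r , eq' rewrite eq with unmerge-≥ k r c (fuel-++ _ r eq' l) c≤r
...     | c≤e , c≤T = HeadAll-map (proj₁ (unmerge k r)) (≤-trans b≤c) c≤e , b≤c ∷ All.map (≤-trans b≤c) c≤T

unmerge-> : ∀ k c z → length z ≤ k → decAt (c ∷ z) ≡ false → All (λ t → c < hd t) (proj₂ (unmerge k z))
unmerge-> zero    c z        _       _ = []
unmerge-> (suc k) c []       _       _ = []
unmerge-> (suc k) c (c' ∷ z) (s≤s l) f with decAt-false⇒≤ c c' z f | decAt-false-true⇒< c c' z f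
... | c≤c' | start⇒c<c' with decAt (c' ∷ z) in e
... | false = All.map (≤-<-trans c≤c') (unmerge-> k c' z l e)
... | true with blockBody-split c' z e
...   | j , c'' , w , r , eq , _ , c'≤r , eq' rewrite eq =
  start⇒c<c' refl ∷ All.map (<-≤-trans (start⇒c<c' refl)) (proj₂ (unmerge-≥ k r c' (fuel-++ _ r eq' l) c'≤r))

merge-∷-below : ∀ c e T → All (λ t → c < hd t) T → merge (c ∷ e) T ≡ c ∷ merge e T
merge-∷-below c e []      _         = cong (c ∷_) (sym (merge-[] e))
merge-∷-below c e (t ∷ T) (c<t ∷ _) = merge-letter c e t T c<t

merge-≤Head-block : ∀ e t T → hd t ≤Head e → merge e (t ∷ T) ≡ t ++ merge e T
merge-≤Head-block []      t T _   = refl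
merge-≤Head-block (c ∷ e) t T t≤c = merge-block c e t T t≤c

merge-unmerge : ∀ k z → length z ≤ k → merge (proj₁ (unmerge k z)) (proj₂ (unmerge k z)) ≡ z
merge-unmerge zero    z       _       = merge-[] z
merge-unmerge (suc k) []      _       = refl
merge-unmerge (suc k) (c ∷ z) (s≤s l) with decAt (c ∷ z) in e
... | false = trans (merge-∷-below c _ _ (unmerge-> k c z l e)) (cong (c ∷_) (merge-unmerge k z l))
... | true with blockBody-split c z e
...   | j , c' , w , r , eq , _ , c≤r , eq' rewrite eq =
  trans (merge-≤Head-block (proj₁ (unmerge k r)) (c ∷ replicate j c ++ c' ∷ w) (proj₂ (unmerge k r))
           (proj₁ (unmerge-≥ k r c (fuel-++ _ r eq' l) c≤r)))
        (cong (c ∷_) (trans (cong ((replicate j c ++ c' ∷ w) ++_) (merge-unmerge k r (fuel-++ _ r eq' l))) eq'))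

Nondecreasing-∷ : ∀ c e → c ≤Head e → Nondecreasing e → Nondecreasing (c ∷ e)
Nondecreasing-∷ c []      _   _  = [-]
Nondecreasing-∷ c (_ ∷ _) c≤e e↑ = c≤e ∷ e↑

unmerge-nondecreasing : ∀ k z → length z ≤ k → Nondecreasing (proj₁ (unmerge k z))
unmerge-nondecreasing zero    []      _       = []
unmerge-nondecreasing (suc k) []      _       = []
unmerge-nondecreasing (suc k) (c ∷ z) (s≤s l) with decAt (c ∷ z) in e
... | false = Nondecreasing-∷ c _ (proj₁ (unmerge-≥ k z c l (decAt-false⇒≤Head c z e))) (unmerge-nondecreasing k z l)
... | true with blockBody-split c z e
...   | j , c' , w , r , eq , _ , _ , eq' rewrite eq = unmerge-nondecreasing k r (fuel-++ _ r eq' l)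

unmerge-headSorted : ∀ k z → length z ≤ k → HeadSorted (proj₂ (unmerge k z))
unmerge-headSorted zero    z       _       = []
unmerge-headSorted (suc k) []      _       = []
unmerge-headSorted (suc k) (c ∷ z) (s≤s l) with decAt (c ∷ z) in e
... | false = unmerge-headSorted k z l
... | true with blockBody-split c z e
...   | j , c' , w , r , eq , _ , c≤r , eq' rewrite eq =
  HeadSorted-∷ (proj₂ (unmerge-≥ k r c (fuel-++ _ r eq' l) c≤r)) (unmerge-headSorted k r (fuel-++ _ r eq' l))

unmerge-LShape : ∀ k z → length z ≤ k → All LShape (proj₂ (unmerge k z))
unmerge-LShape zero    z       _       = []
unmerge-LShape (suc k) []      _       = []
unmerge-LShape (suc k) (c ∷ z) (s≤s l) with decAt (c ∷ z) in e
... | false = unmerge-LShape k z l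
... | true with blockBody-split c z e
...   | j , c' , w , r , eq , c'∷w<c , _ , eq' rewrite eq =
  lshape j c' w c'∷w<c ∷ unmerge-LShape k r (fuel-++ _ r eq' l)

-- The bijection on lists of words

HeadSorted-++ : ∀ x lo hi → HeadSorted lo → HeadSorted hi →
                All (λ t → hd t < x) lo → All (λ t → x ≤ hd t) hi → HeadSorted (lo ++ hi)
HeadSorted-++ x []            hi      _            hi↑ _           _          = hi↑
HeadSorted-++ x (t ∷ [])      []      _            _   _           _          = [-]
HeadSorted-++ x (t ∷ [])      (_ ∷ _) _            hi↑ (t<x ∷ _)  (x≤t' ∷ _) = <⇒≤ (<-≤-trans t<x x≤t') ∷ hi↑
HeadSorted-++ x (t ∷ t' ∷ lo) hi      (t≤t' ∷ lo↑) hi↑ (_ ∷ lo<x) x≤hi       =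
  t≤t' ∷ HeadSorted-++ x (t' ∷ lo) hi lo↑ hi↑ lo<x x≤hi

HeadSorted-++⁻ˡ : ∀ lo hi → HeadSorted (lo ++ hi) → HeadSorted lo
HeadSorted-++⁻ˡ []            hi _          = []
HeadSorted-++⁻ˡ (t ∷ [])      hi _          = [-]
HeadSorted-++⁻ˡ (t ∷ t' ∷ lo) hi (t≤t' ∷ s) = t≤t' ∷ HeadSorted-++⁻ˡ (t' ∷ lo) hi s

HeadSorted-++⁻ʳ : ∀ lo hi → HeadSorted (lo ++ hi) → HeadSorted hi
HeadSorted-++⁻ʳ []       hi s = s
HeadSorted-++⁻ʳ (t ∷ lo) hi s = HeadSorted-++⁻ʳ lo hi (Linked.tail s)

HeadSorted⇒All≥-HeadAll : ∀ {x} T → HeadAll (λ t → x ≤ hd t) T → HeadSorted T → All (λ t → x ≤ hd t) T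
HeadSorted⇒All≥-HeadAll []      _   _ = []
HeadSorted⇒All≥-HeadAll (t ∷ T) x≤t s = HeadSorted⇒All≥ x≤t s

spanBelow : ℕ → List Word → List Word × List Word
spanBelow x = span (λ t → hd t <? x)

spanBelow-++ : ∀ x lo hi → All (λ t → hd t < x) lo → All (λ t → x ≤ hd t) hi →
               spanBelow x (lo ++ hi) ≡ (lo , hi)
spanBelow-++ x lo []      lo<x _           = span-++ _ lo [] lo<x tt
spanBelow-++ x lo (t ∷ _) lo<x (x≤t ∷ _) = span-++ _ lo (t ∷ _) lo<x (≤⇒≯ x≤t)

Nonincreasing⇒All≤ : ∀ {y a} → Nonincreasing (y ∷ a) → All (_≤ y) (y ∷ a)
Nonincreasing⇒All≤ = Linked⇒All (λ a≥b b≥c → ≤-trans b≥c a≥b) ≤-refl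

Nondecreasing⇒All≤lastOf : ∀ m b → Nondecreasing (m ∷ b) → All (_≤ lastOf m b) (m ∷ b)
Nondecreasing⇒All≤lastOf m []       _           = ≤-refl ∷ []
Nondecreasing⇒All≤lastOf m (m' ∷ b) (m≤m' ∷ b↑) with Nondecreasing⇒All≤lastOf m' b b↑
... | m'≤l ∷ b≤l = ≤-trans m≤m' m'≤l ∷ m'≤l ∷ b≤l

LShape-All≤ : ∀ {t} → LShape t → All (_≤ hd t) t
LShape-All≤ (lshape j c w c∷w<x) = ≤-refl ∷ All.++⁺ (All.replicate⁺ j ≤-refl) (All.map <⇒≤ c∷w<x)

LShape-plateau : ∀ {x s} → LShape (x ∷ s) → LShape (x ∷ x ∷ s)
LShape-plateau (lshape j c w c∷w<x) = lshape (suc j) c w c∷w<x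

LShape-descendingRun-++ : ∀ x a c z → Nonincreasing (x ∷ a) → All (_< x) (c ∷ z) → LShape ((x ∷ a) ++ c ∷ z)
LShape-descendingRun-++ x []      c z _             c∷z<x = lshape 0 c z c∷z<x
LShape-descendingRun-++ x (y ∷ a) c z (y≤x ∷ a↓) c∷z<x with m≤n⇒m<n∨m≡n y≤x
... | inj₁ y<x = lshape 0 y (a ++ c ∷ z) (y<x ∷ All.++⁺ (All.map (λ b≤y → ≤-<-trans b≤y y<x) a≤y) c∷z<x)
  where a≤y = All.tail (Nonincreasing⇒All≤ a↓)
... | inj₂ refl = LShape-plateau (LShape-descendingRun-++ x a c z a↓ c∷z<x)

LShapes-below : ∀ x lo → All LShape lo → All (λ t → hd t < x) lo → All (All (_< x)) lo
LShapes-below x []       _          _           = []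
LShapes-below x (_ ∷ lo) (t⊢ ∷ T⊢) (t<x ∷ lo<x) =
  All.map (λ c≤t → ≤-<-trans c≤t t<x) (LShape-All≤ t⊢) ∷ LShapes-below x lo T⊢ lo<x

uToL : List Word → List Word
uToL []      = []
uToL (u ∷ S) =
  (proj₁ (descentSplit u) ++ merge (proj₂ (descentSplit u)) (proj₁ (spanBelow (hd u) (uToL S))))
  ∷ proj₂ (spanBelow (hd u) (uToL S))

uToL-∷ : ∀ u S D A lo hi → descentSplit u ≡ (D , A) → spanBelow (hd u) (uToL S) ≡ (lo , hi) →
         uToL (u ∷ S) ≡ (D ++ merge A lo) ∷ hi
uToL-∷ u S D A lo hi eq eq' rewrite eq | eq' = refl

-- The condition rmin u < max u' of U*, with max u' = hd u' (UWord-maxL).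
data UChain : List Word → Set where
  []   : UChain []
  cons : ∀ {u m S} → UWordWithRmin u m → HeadAll (λ u' → m < hd u') S → UChain S → UChain (u ∷ S)

record UToLStep (u : Word) (S : List Word) : Set where
  field
    x m       : ℕ
    a b       : Word
    lo hi     : List Word
    u≡        : u ≡ (x ∷ a) ++ m ∷ b
    uToL≡     : uToL (u ∷ S) ≡ ((x ∷ a) ++ m ∷ merge b lo) ∷ hi
    lo++hi≡   : lo ++ hi ≡ uToL S
    a↓        : Nonincreasing (x ∷ a)
    m<a       : m < lastOf x a
    b↑        : Nondecreasing (m ∷ b)
    b<x       : lastOf m b < x
    lo-shapes : All LShape lo
    lo-sorted : HeadSorted lo
    m<lo      : All (λ t → m < hd t) lo
    lo<x      : All (λ t → hd t < x) lo
    hi-shapes : All LShape hi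
    hi-sorted : HeadSorted hi
    x≤hi      : All (λ t → x ≤ hd t) hi

uToL-step : ∀ u S m → UWordWithRmin u m → All LShape (uToL S) → HeadSorted (uToL S) →
            All (λ t → m < hd t) (uToL S) → UToLStep u S
uToL-step u S m (x , a , b , refl , a↓ , m<a , b↑ , b<x) T⊢ T↑ m<T = record
  { x = x ; m = m ; a = a ; b = b ; lo = lo ; hi = hi
  ; u≡ = refl
  ; uToL≡ = trans (uToL-∷ u S (x ∷ a) (m ∷ b) lo hi
                      (descentSplit-descendingRun x a m b a↓ m<a (decAt-nondecreasing m b b↑)) refl)
                  (cong (λ z → ((x ∷ a) ++ z) ∷ hi) (merge-∷-below m b lo m<lo))
  ; lo++hi≡ = lo++hi≡
  ; a↓ = a↓ ; m<a = m<a ; b↑ = b↑ ; b<x = b<x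
  ; lo-shapes = All.++⁻ˡ lo (subst (All LShape) (sym lo++hi≡) T⊢)
  ; lo-sorted = HeadSorted-++⁻ˡ lo hi (subst HeadSorted (sym lo++hi≡) T↑)
  ; m<lo = m<lo
  ; lo<x = lo<x
  ; hi-shapes = All.++⁻ʳ lo (subst (All LShape) (sym lo++hi≡) T⊢)
  ; hi-sorted = hi↑
  ; x≤hi = HeadSorted⇒All≥-HeadAll hi (HeadAll-map hi ≮⇒≥ x≰hi) hi↑
  }
  where
  lo = proj₁ (spanBelow x (uToL S))
  hi = proj₂ (spanBelow x (uToL S))
  spec = span-spec (λ t → hd t <? x) (uToL S)
  lo<x = proj₁ spec
  x≰hi = proj₁ (proj₂ spec)
  lo++hi≡ = proj₂ (proj₂ spec)
  m<lo = All.++⁻ˡ lo (subst (All (λ t → m < hd t)) (sym lo++hi≡) m<T)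
  hi↑ = HeadSorted-++⁻ʳ lo hi (subst HeadSorted (sym lo++hi≡) T↑)

LSeqFrom : List Word → List Word → Set
LSeqFrom S L = All LShape L × HeadSorted L × (∀ c → HeadAll (λ u → c < hd u) S → All (λ t → c < hd t) L)

uToL-valid : ∀ S → UChain S → LSeqFrom S (uToL S)
uToL-valid [] [] = [] , [] , λ _ _ → []
uToL-valid (u ∷ S) (cons {m = rmin} u⊢ rmin<S S⊢) with uToL-valid S S⊢
... | T⊢ , T↑ , T-above = subst (LSeqFrom (u ∷ S)) (sym uToL≡)
  (first-shape ∷ hi-shapes , HeadSorted-∷ x≤hi hi-sorted ,
   λ c c<u → c<x c c<u ∷ All.map (<-≤-trans (c<x c c<u)) x≤hi)
  where
  open UToLStep (uToL-step u S rmin u⊢ T⊢ T↑ (T-above rmin rmin<S))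
  c<x : ∀ c → c < hd u → c < x
  c<x c c<u = subst (c <_) (cong hd u≡) c<u
  m∷b<x : All (_< x) (m ∷ b)
  m∷b<x = All.map (λ c≤l → ≤-<-trans c≤l b<x) (Nondecreasing⇒All≤lastOf m b b↑)
  merged<x : All (_< x) (m ∷ merge b lo)
  merged<x = subst (All (_< x)) (merge-∷-below m b lo m<lo)
    (All-resp-↭ (↭-sym (merge-↭ (m ∷ b) lo)) (All.++⁺ m∷b<x (All.concat⁺ (LShapes-below x lo lo-shapes lo<x))))
  first-shape : LShape ((x ∷ a) ++ m ∷ merge b lo)
  first-shape = LShape-descendingRun-++ x a m (merge b lo) a↓ merged<x

sum-map-++ : ∀ (f : Word → ℕ) lo hi → sum (map f (lo ++ hi)) ≡ sum (map f lo) + sum (map f hi)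
sum-map-++ f lo hi = trans (cong sum (map-++ f lo hi)) (sum-++ (map f lo) (map f hi))

dec-descendingRun-nondecreasing : ∀ x a m b → Nonincreasing (x ∷ a) → m < lastOf x a → Nondecreasing (m ∷ b) →
                                  dec ((x ∷ a) ++ m ∷ b) ≡ length (x ∷ a)
dec-descendingRun-nondecreasing x a m b a↓ m<a b↑ =
  trans (dec-descendingRun x a m b a↓ m<a)
        (trans (cong (length (x ∷ a) +_) (dec-nondecreasing (m ∷ b) b↑)) (+-identityʳ _))

dec-uToL-first : ∀ {u S} (st : UToLStep u S) → let open UToLStep st in
                 dec ((x ∷ a) ++ m ∷ merge b lo) ≡ dec u + sum (map dec lo)
dec-uToL-first {u} st = begin
    dec ((x ∷ a) ++ m ∷ merge b lo)
  ≡⟨ dec-descendingRun x a m (merge b lo) a↓ m<a ⟩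
    length (x ∷ a) + dec (m ∷ merge b lo)
  ≡⟨ cong (λ w → length (x ∷ a) + dec w) (sym (merge-∷-below m b lo m<lo)) ⟩
    length (x ∷ a) + dec (merge (m ∷ b) lo)
  ≡⟨ cong (length (x ∷ a) +_) (dec-merge (m ∷ b) lo b↑ lo-sorted lo-shapes) ⟩
    length (x ∷ a) + sum (map dec lo)
  ≡⟨ cong (_+ sum (map dec lo)) (sym (trans (cong dec u≡) (dec-descendingRun-nondecreasing x a m b a↓ m<a b↑))) ⟩
    dec u + sum (map dec lo)
  ∎
  where
  open ≡-Reasoning
  open UToLStep st

uToL-dec : ∀ S → UChain S → sum (map dec (uToL S)) ≡ sum (map dec S)
uToL-dec [] [] = refl
uToL-dec (u ∷ S) (cons {m = rmin} u⊢ rmin<S S⊢) with uToL-valid S S⊢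
... | T⊢ , T↑ , T-above = begin
    sum (map dec (uToL (u ∷ S)))
  ≡⟨ cong (sum ∘ map dec) uToL≡ ⟩
    dec ((x ∷ a) ++ m ∷ merge b lo) + sum (map dec hi)
  ≡⟨ cong (_+ sum (map dec hi)) (dec-uToL-first st) ⟩
    dec u + sum (map dec lo) + sum (map dec hi)
  ≡⟨ +-assoc (dec u) _ _ ⟩
    dec u + (sum (map dec lo) + sum (map dec hi))
  ≡⟨ cong (dec u +_) (sym (sum-map-++ dec lo hi)) ⟩
    dec u + sum (map dec (lo ++ hi))
  ≡⟨ cong (λ L → dec u + sum (map dec L)) lo++hi≡ ⟩
    dec u + sum (map dec (uToL S))
  ≡⟨ cong (dec u +_) (uToL-dec S S⊢) ⟩
    dec u + sum (map dec S)
  ∎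
  where
  open ≡-Reasoning
  st = uToL-step u S rmin u⊢ T⊢ T↑ (T-above rmin rmin<S)
  open UToLStep st

uToL-↭ : ∀ S → UChain S → concat (uToL S) ↭ concat S
uToL-↭ [] [] = ↭-refl
uToL-↭ (u ∷ S) (cons {m = rmin} u⊢ rmin<S S⊢) with uToL-valid S S⊢
... | T⊢ , T↑ , T-above = begin
    concat (uToL (u ∷ S))
  ≡⟨ cong concat uToL≡ ⟩
    ((x ∷ a) ++ m ∷ merge b lo) ++ concat hi
  ≡⟨ cong (λ w → ((x ∷ a) ++ w) ++ concat hi) (sym (merge-∷-below m b lo m<lo)) ⟩
    ((x ∷ a) ++ merge (m ∷ b) lo) ++ concat hi
  ↭⟨ ++⁺ʳ (concat hi) (++⁺ˡ (x ∷ a) (merge-↭ (m ∷ b) lo)) ⟩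
    ((x ∷ a) ++ (m ∷ b) ++ concat lo) ++ concat hi
  ≡⟨ ++-assoc-middle (x ∷ a) (m ∷ b) (concat lo) (concat hi) ⟩
    ((x ∷ a) ++ m ∷ b) ++ concat lo ++ concat hi
  ≡⟨ cong₂ _++_ (sym u≡) (trans (concat-++ lo hi) (cong concat lo++hi≡)) ⟩
    u ++ concat (uToL S)
  ↭⟨ ++⁺ˡ u (uToL-↭ S S⊢) ⟩
    u ++ concat S
  ∎
  where
  open PermutationReasoning
  open UToLStep (uToL-step u S rmin u⊢ T⊢ T↑ (T-above rmin rmin<S))
  ++-assoc-middle : ∀ (p q r s : Word) → (p ++ q ++ r) ++ s ≡ (p ++ q) ++ r ++ s
  ++-assoc-middle p q r s = trans (cong (_++ s) (sym (++-assoc p q r))) (++-assoc (p ++ q) r s)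

-- As for unmerge, the fuel must be at least the number of letters.
lToU : ℕ → List Word → List Word
lToU zero    _        = []
lToU (suc k) []       = []
lToU (suc k) (l ∷ ls) =
  let (D , z) = descentSplit l ; (A , lo) = unmerge (length z) z in (D ++ A) ∷ lToU k (lo ++ ls)

lToU-∷ : ∀ k l ls D z A lo → descentSplit l ≡ (D , z) → unmerge (length z) z ≡ (A , lo) →
         lToU (suc k) (l ∷ ls) ≡ (D ++ A) ∷ lToU k (lo ++ ls)
lToU-∷ k l ls D z A lo eq eq' rewrite eq | eq' = refl

lToU-uToL : ∀ k S → UChain S → length (concat S) ≤ k → lToU k (uToL S) ≡ S
lToU-uToL zero    []      []                                    _ = refl
lToU-uToL zero    (u ∷ S) (cons (_ , _ , _ , refl , _) _ _)      ()
lToU-uToL (suc k) []      []                                    _ = refl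
lToU-uToL (suc k) (u ∷ S) (cons {m = rmin} u⊢@(x₁ , a₁ , b₁ , refl , _) rmin<S S⊢) l with uToL-valid S S⊢
... | T⊢ , T↑ , T-above = begin
    lToU (suc k) (uToL (u ∷ S))
  ≡⟨ cong (lToU (suc k)) uToL≡ ⟩
    lToU (suc k) (((x ∷ a) ++ m ∷ merge b lo) ∷ hi)
  ≡⟨ lToU-∷ k _ hi (x ∷ a) (m ∷ merge b lo) (m ∷ b) lo
       (descentSplit-descendingRun x a m (merge b lo) a↓ m<a (decAt-merge m b lo b↑ m<lo lo-shapes)) unmerge≡ ⟩
    ((x ∷ a) ++ m ∷ b) ∷ lToU k (lo ++ hi)
  ≡⟨ cong₂ _∷_ (sym u≡) (cong (lToU k) lo++hi≡) ⟩
    u ∷ lToU k (uToL S)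
  ≡⟨ cong (u ∷_) (lToU-uToL k S S⊢ (fuel-∷-++ x₁ (a₁ ++ rmin ∷ b₁) (concat S) l)) ⟩
    u ∷ S
  ∎
  where
  open ≡-Reasoning
  open UToLStep (uToL-step u S rmin u⊢ T⊢ T↑ (T-above rmin rmin<S))
  unmerge≡ : unmerge (length (m ∷ merge b lo)) (m ∷ merge b lo) ≡ (m ∷ b , lo)
  unmerge≡ = subst (λ z → unmerge (length z) z ≡ (m ∷ b , lo)) (merge-∷-below m b lo m<lo)
    (unmerge-merge (length (merge (m ∷ b) lo)) (m ∷ b) lo b↑ lo-sorted lo-shapes ≤-refl)

descentSplit-plateauThenDescent : ∀ x j c w → c < x →
  proj₂ (descentSplit (x ∷ replicate j x ++ c ∷ w)) ≡ proj₂ (descentSplit (c ∷ w))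
descentSplit-plateauThenDescent x zero    c w c<x rewrite decAt-descent w c<x = refl
descentSplit-plateauThenDescent x (suc j) c w c<x
  rewrite decAt-plateauThenDescent x (suc j) c w c<x = descentSplit-plateauThenDescent x j c w c<x

descentSplit-suffix-All : ∀ {P : ℕ → Set} w → All P w → All P (proj₂ (descentSplit w))
descentSplit-suffix-All w Pw = All.++⁻ʳ (proj₁ (descentSplit w)) (subst (All _) (sym (descentSplit-++ w)) Pw)

LShape-hd< : ∀ {x t} → LShape t → All (_< x) t → hd t < x
LShape-hd< (lshape _ _ _ _) t<x = All.head t<x

record LToUStep (l : Word) : Set where
  field
    x m           : ℕ
    ds z e        : Word
    lo            : List Word
    l≡            : l ≡ (x ∷ ds) ++ m ∷ z
    descentSplit≡ : descentSplit l ≡ (x ∷ ds , m ∷ z)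
    unmerge≡      : unmerge (length (m ∷ z)) (m ∷ z) ≡ (m ∷ e , lo)
    merge≡        : merge (m ∷ e) lo ≡ m ∷ z
    ds↓           : Nonincreasing (x ∷ ds)
    m<ds          : m < lastOf x ds
    e↑            : Nondecreasing (m ∷ e)
    e<x           : All (_< x) (m ∷ e)
    lo-shapes     : All LShape lo
    lo-sorted     : HeadSorted lo
    m<lo          : All (λ t → m < hd t) lo
    lo<x          : All (λ t → hd t < x) lo
    lo-shorter    : suc (length (concat lo)) ≤ length l

lToU-step : ∀ l → LShape l → LToUStep l
lToU-step l (lshape {x} j c w c∷w<x)
  with descentSplit-shape x (replicate j x ++ c ∷ w) (decAt-plateauThenDescent x j c w (All.head c∷w<x))
... | ds , m , z , split≡ , ds↓ , m<ds , m-stop = record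
  { x = x ; m = m ; ds = ds ; z = z ; e = e ; lo = lo
  ; l≡ = l≡
  ; descentSplit≡ = split≡
  ; unmerge≡ = unmerge-letter (length z) m z m-stop
  ; merge≡ = merge≡
  ; ds↓ = ds↓ ; m<ds = m<ds
  ; e↑ = Nondecreasing-∷ m e (proj₁ (unmerge-≥ n z m ≤-refl (decAt-false⇒≤Head m z m-stop)))
                           (unmerge-nondecreasing n z ≤-refl)
  ; e<x = All.++⁻ˡ (m ∷ e) letters<x
  ; lo-shapes = lo-shapes
  ; lo-sorted = unmerge-headSorted n z ≤-refl
  ; m<lo = m<lo
  ; lo<x = All.zipWith (λ (t⊢ , t<x) → LShape-hd< t⊢ t<x) (lo-shapes , All.concat⁻ (All.++⁻ʳ (m ∷ e) letters<x))
  ; lo-shorter = ≤-trans lo-shorter-than-suffix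
                   (subst (λ w → length (m ∷ z) ≤ length w) (sym l≡) (length-++-≤ʳ (m ∷ z) {x ∷ ds}))
  }
  where
  n = length z
  e = proj₁ (unmerge n z)
  lo = proj₂ (unmerge n z)
  l≡ = trans (sym (descentSplit-++ _)) (cong (λ p → proj₁ p ++ proj₂ p) split≡)
  lo-shapes = unmerge-LShape n z ≤-refl
  m<lo = unmerge-> n m z ≤-refl m-stop
  merge≡ = trans (merge-∷-below m e lo m<lo) (cong (m ∷_) (merge-unmerge n z ≤-refl))
  suffix<x : All (_< x) (m ∷ z)
  suffix<x = subst (All (_< x)) (trans (sym (descentSplit-plateauThenDescent x j c w (All.head c∷w<x))) (cong proj₂ split≡))
                   (descentSplit-suffix-All (c ∷ w) c∷w<x)
  merge-↭-suffix : (m ∷ e) ++ concat lo ↭ m ∷ z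
  merge-↭-suffix = ↭-trans (↭-sym (merge-↭ (m ∷ e) lo)) (↭-reflexive merge≡)
  letters<x : All (_< x) ((m ∷ e) ++ concat lo)
  letters<x = All-resp-↭ (↭-sym merge-↭-suffix) suffix<x
  lo-shorter-than-suffix : suc (length (concat lo)) ≤ length (m ∷ z)
  lo-shorter-than-suffix = subst (suc (length (concat lo)) ≤_) (trans (sym (length-++ (m ∷ e))) (↭-length merge-↭-suffix))
                                 (s≤s (m≤n+m (length (concat lo)) (length e)))

fuel-lToU : ∀ {k} (l : Word) (ls lo : List Word) → suc (length (concat lo)) ≤ length l →
            length (concat (l ∷ ls)) ≤ suc k → length (concat (lo ++ ls)) ≤ k
fuel-lToU {k} l ls lo lo<l l∷ls≤ =
  subst (_≤ k) (sym (trans (cong length (sym (concat-++ lo ls))) (length-++ (concat lo))))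
    (≤-pred (≤-trans (+-monoˡ-≤ (length (concat ls)) lo<l) (subst (_≤ suc k) (length-++ l) l∷ls≤)))

UChainFrom : List Word → List Word → Set
UChainFrom L S = UChain S × (∀ c → All (λ t → c < hd t) L → HeadAll (λ u → c < hd u) S)

lToU-valid : ∀ k L → All LShape L → HeadSorted L → length (concat L) ≤ k → UChainFrom L (lToU k L)
lToU-valid zero    L        _           _  _ = [] , λ _ _ → tt
lToU-valid (suc k) []       _           _  _ = [] , λ _ _ → tt
lToU-valid (suc k) (l ∷ ls) (l⊢ ∷ ls⊢) L↑ L≤ =
  subst (UChainFrom (l ∷ ls)) (sym (lToU-∷ k l ls (x ∷ ds) (m ∷ z) (m ∷ e) lo descentSplit≡ unmerge≡))
    (cons (x , ds , e , refl , ds↓ , m<ds , e↑ , All-lastOf m e e<x) (proj₂ rest m m<rest) (proj₁ rest) ,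
     λ c c<l → subst (c <_) (cong hd l≡) (All.head c<l))
  where
  open LToUStep (lToU-step l l⊢)
  x≤ls : All (λ t → x ≤ hd t) ls
  x≤ls = subst (λ y → All (λ t → y ≤ hd t) ls) (cong hd l≡) (HeadSorted-head L↑)
  rest = lToU-valid k (lo ++ ls) (All.++⁺ lo-shapes ls⊢) (HeadSorted-++ x lo ls lo-sorted (Linked.tail L↑) lo<x x≤ls)
           (fuel-lToU l ls lo lo-shorter L≤)
  m<rest : All (λ t → m < hd t) (lo ++ ls)
  m<rest = All.++⁺ m<lo (All.map (<-≤-trans (All.head e<x)) x≤ls)

uToL-lToU : ∀ k L → All LShape L → HeadSorted L → length (concat L) ≤ k → uToL (lToU k L) ≡ L
uToL-lToU zero    []       _                         _  _ = refl
uToL-lToU zero    (_ ∷ _)  (lshape _ _ _ _ ∷ _)      _  ()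
uToL-lToU (suc k) []       _                         _  _ = refl
uToL-lToU (suc k) (l ∷ ls) (l⊢ ∷ ls⊢) L↑ L≤ = begin
    uToL (lToU (suc k) (l ∷ ls))
  ≡⟨ cong uToL (lToU-∷ k l ls (x ∷ ds) (m ∷ z) (m ∷ e) lo descentSplit≡ unmerge≡) ⟩
    uToL (((x ∷ ds) ++ m ∷ e) ∷ lToU k (lo ++ ls))
  ≡⟨ uToL-∷ ((x ∷ ds) ++ m ∷ e) (lToU k (lo ++ ls)) (x ∷ ds) (m ∷ e) lo ls
       (descentSplit-descendingRun x ds m e ds↓ m<ds (decAt-nondecreasing m e e↑)) spanBelow≡ ⟩
    ((x ∷ ds) ++ merge (m ∷ e) lo) ∷ ls
  ≡⟨ cong (λ w → ((x ∷ ds) ++ w) ∷ ls) merge≡ ⟩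
    ((x ∷ ds) ++ m ∷ z) ∷ ls
  ≡⟨ cong (_∷ ls) (sym l≡) ⟩
    l ∷ ls
  ∎
  where
  open ≡-Reasoning
  open LToUStep (lToU-step l l⊢)
  x≤ls : All (λ t → x ≤ hd t) ls
  x≤ls = subst (λ y → All (λ t → y ≤ hd t) ls) (cong hd l≡) (HeadSorted-head L↑)
  spanBelow≡ : spanBelow x (uToL (lToU k (lo ++ ls))) ≡ (lo , ls)
  spanBelow≡ = trans (cong (spanBelow x) (uToL-lToU k (lo ++ ls) (All.++⁺ lo-shapes ls⊢)
                        (HeadSorted-++ x lo ls lo-sorted (Linked.tail L↑) lo<x x≤ls) (fuel-lToU l ls lo lo-shorter L≤)))
                     (spanBelow-++ x lo ls lo<x x≤ls)

-- L-words

RotationsBelow : Word → Set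
RotationsBelow t = ∀ k → 1 ≤ k → k < length t → rotate k t <lex t

<lex-irrefl : ∀ w → ¬ (w <lex w)
<lex-irrefl w = LexStrict.<-irreflexive (λ { refl → n≮n _ }) (Pointwise.refl refl)

<lex-replicate : ∀ i x c r₁ r₂ → c < x → (replicate i x ++ c ∷ r₁) <lex (replicate i x ++ x ∷ r₂)
<lex-replicate zero    x c r₁ r₂ c<x = this c<x
<lex-replicate (suc i) x c r₁ r₂ c<x = next refl (<lex-replicate i x c r₁ r₂ c<x)

<lex-head≤ : ∀ {y x a b} → (y ∷ a) <lex (x ∷ b) → y ≤ x
<lex-head≤ (this y<x)    = <⇒≤ y<x
<lex-head≤ (next refl _) = ≤-refl

replicate-split : ∀ x i j (v : Word) → i ≤ j →
                  x ∷ replicate j x ++ v ≡ replicate i x ++ x ∷ replicate (j ∸ i) x ++ v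
replicate-split x zero    j       v _         = refl
replicate-split x (suc i) (suc j) v (s≤s i≤j) = cong (x ∷_) (replicate-split x i j v i≤j)

drop-nonempty : ∀ k (s : Word) → k < length s → Σ ℕ λ d → Σ Word λ q → drop k s ≡ d ∷ q
drop-nonempty zero    (d ∷ q) _         = d , q , refl
drop-nonempty (suc k) (_ ∷ s) (s≤s k<s) = drop-nonempty k s k<s

LShape-suffix : ∀ x j c w p d q → All (_< x) (c ∷ w) → replicate j x ++ c ∷ w ≡ p ++ d ∷ q →
                (Σ ℕ λ i → i ≤ j × d ∷ q ≡ replicate i x ++ c ∷ w) ⊎ d < x
LShape-suffix x j       c w []      d q _       eq = inj₁ (j , ≤-refl , sym eq)
LShape-suffix x zero    c w (_ ∷ p) d q c∷w<x eq =
  inj₂ (All.head (All.++⁻ʳ p (subst (All (_< x)) (∷-injectiveʳ eq) (All.tail c∷w<x))))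
LShape-suffix x (suc j) c w (_ ∷ p) d q c∷w<x eq with LShape-suffix x j c w p d q c∷w<x (∷-injectiveʳ eq)
... | inj₁ (i , i≤j , eq') = inj₁ (i , m≤n⇒m≤1+n i≤j , eq')
... | inj₂ d<x             = inj₂ d<x

LShape-rotationsBelow : ∀ {t} → LShape t → RotationsBelow t
LShape-rotationsBelow (lshape {x} j c w c∷w<x) (suc k) _ (s≤s k<s) with drop-nonempty k (replicate j x ++ c ∷ w) k<s
... | d , q , drop≡ = subst (λ r → (r ++ x ∷ take k s) <lex (x ∷ s)) (sym drop≡)
  (compare (LShape-suffix x j c w (take k s) d q c∷w<x (trans (sym (take++drop≡id k s)) (cong (take k s ++_) drop≡))))
  where
  s = replicate j x ++ c ∷ w
  compare : (Σ ℕ λ i → i ≤ j × d ∷ q ≡ replicate i x ++ c ∷ w) ⊎ d < x →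
            (d ∷ q ++ x ∷ take k s) <lex (x ∷ s)
  compare (inj₂ d<x)            = this d<x
  compare (inj₁ (i , i≤j , eq)) = subst₂ _<lex_
    (sym (trans (cong (_++ x ∷ take k s) eq) (++-assoc (replicate i x) (c ∷ w) (x ∷ take k s))))
    (sym (replicate-split x i j (c ∷ w) i≤j))
    (<lex-replicate i x c (w ++ x ∷ take k s) (replicate (j ∸ i) x ++ c ∷ w) (All.head c∷w<x))

LShape-headNotRepeated : ∀ x j c w → All (_< x) (c ∷ w) →
                         ∀ p s → replicate j x ++ c ∷ w ≡ p ++ x ∷ s → All (_≡ x) p
LShape-headNotRepeated x j       c w c∷w<x []      s eq = []
LShape-headNotRepeated x zero    c w c∷w<x (_ ∷ p) s eq =
  contradiction (All.head (All.++⁻ʳ p (subst (All (_< x)) (∷-injectiveʳ eq) (All.tail c∷w<x)))) (n≮n x)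
LShape-headNotRepeated x (suc j) c w c∷w<x (_ ∷ p) s eq =
  sym (∷-injectiveˡ eq) ∷ LShape-headNotRepeated x j c w c∷w<x p s (∷-injectiveʳ eq)

LShape⇒LWord : ∀ {t} → LShape t → LWord t
LShape⇒LWord t⊢@(lshape {x} j c w c∷w<x) =
  ((λ ()) , inj₂ (LShape-rotationsBelow t⊢)) ,
  s≤s (≤-trans (s≤s z≤n) (length-++-≤ʳ (c ∷ w) {replicate j x})) ,
  λ x' p s eq → headNotRepeated (∷-injectiveˡ eq) p s (∷-injectiveʳ eq)
  where
  headNotRepeated : ∀ {x'} → x ≡ x' → ∀ p s → replicate j x ++ c ∷ w ≡ p ++ x' ∷ s → All (_≡ x') p
  headNotRepeated refl = LShape-headNotRepeated x j c w c∷w<x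

drop-length-++ : ∀ (s r : Word) → drop (length s) (s ++ r) ≡ r
drop-length-++ []      r = refl
drop-length-++ (_ ∷ s) r = drop-length-++ s r

rotationsBelow-letter≤ : ∀ x s₁ y s₂ → RotationsBelow (x ∷ s₁ ++ y ∷ s₂) → y ≤ x
rotationsBelow-letter≤ x s₁ y s₂ rot = <lex-head≤ (subst (λ r → (r ++ x ∷ take (length s₁) s) <lex (x ∷ s))
  (drop-length-++ s₁ (y ∷ s₂))
  (rot (suc (length s₁)) (s≤s z≤n)
       (s≤s (subst (length s₁ <_) (sym (length-++ s₁)) (m<m+n (length s₁) (s≤s z≤n))))))
  where s = s₁ ++ y ∷ s₂

rotationsBelow⇒All≤ : ∀ x s → RotationsBelow (x ∷ s) → All (_≤ x) s
rotationsBelow⇒All≤ x s rot = All.tabulate λ {y} y∈s →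
  let (s₁ , s₂ , s≡) = ∈-∃++ y∈s in
  rotationsBelow-letter≤ x s₁ y s₂ (subst (λ s → RotationsBelow (x ∷ s)) s≡ rot)

replicate-prefix : ∀ x (s : Word) → Σ ℕ λ j → Σ Word λ v → (s ≡ replicate j x ++ v) × HeadAll (_≢ x) v
replicate-prefix x []      = 0 , [] , refl , tt
replicate-prefix x (y ∷ s) with y ≟ x
... | yes refl = let (j , v , s≡ , v≢x) = replicate-prefix x s in suc j , v , cong (x ∷_) s≡ , v≢x
... | no  y≢x  = 0 , y ∷ s , refl , y≢x

replicate-++-[_] : ∀ (x : ℕ) j → replicate j x ++ [ x ] ≡ x ∷ replicate j x
replicate-++-[ x ] zero    = refl
replicate-++-[ x ] (suc j) = cong (x ∷_) (replicate-++-[ x ] j)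

LWord⇒LShape : ∀ {t} → LWord t → LShape t
LWord⇒LShape {[]}    ((t≢[] , _) , _) = contradiction refl t≢[]
LWord⇒LShape {x ∷ s} ((_ , inj₁ len≡1) , 2≤len , _) = contradiction 2≤len (<-irrefl (sym len≡1))
LWord⇒LShape {x ∷ s} ((_ , inj₂ rot) , 2≤len , noRepeat) with replicate-prefix x s
... | j , [] , refl , _ = contradiction (subst (_<lex (x ∷ s)) rotate1≡ (rot 1 (s≤s z≤n) 2≤len)) (<lex-irrefl (x ∷ s))
  where
  rotate1≡ : (replicate j x ++ []) ++ [ x ] ≡ x ∷ replicate j x ++ []
  rotate1≡ rewrite ++-identityʳ (replicate j x) = replicate-++-[ x ] j
... | j , c ∷ w , refl , c≢x =
  lshape j c w (≤∧≢⇒< (All.head c∷w≤x) c≢x ∷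
                All.tabulate (λ y∈w → ≤∧≢⇒< (All.lookup (All.tail c∷w≤x) y∈w) (notRepeated y∈w)))
  where
  c∷w≤x : All (_≤ x) (c ∷ w)
  c∷w≤x = All.++⁻ʳ (replicate j x) (rotationsBelow⇒All≤ x _ rot)
  notRepeated : ∀ {y} → y ∈ w → y ≢ x
  notRepeated {y} y∈w refl = c≢x (All.head (All.++⁻ʳ (replicate j x) (noRepeat x (replicate j x ++ c ∷ w₁) w₂ t≡)))
    where
    w₁ = proj₁ (∈-∃++ y∈w)
    w₂ = proj₁ (proj₂ (∈-∃++ y∈w))
    t≡ : x ∷ replicate j x ++ c ∷ w ≡ x ∷ (replicate j x ++ c ∷ w₁) ++ x ∷ w₂
    t≡ = cong (x ∷_) (trans (cong (λ v → replicate j x ++ c ∷ v) (proj₂ (proj₂ (∈-∃++ y∈w))))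
                            (sym (++-assoc (replicate j x) (c ∷ w₁) (x ∷ w₂))))

-- Sequences

maxL-All≤ : ∀ {x} s → All (_≤ x) s → maxL s ≤ x
maxL-All≤ []      _          = z≤n
maxL-All≤ (_ ∷ s) (y≤x ∷ s≤x) = ⊔-lub y≤x (maxL-All≤ s s≤x)

maxL-∷-All≤ : ∀ x s → All (_≤ x) s → maxL (x ∷ s) ≡ x
maxL-∷-All≤ x s s≤x = m≥n⇒m⊔n≡m (maxL-All≤ s s≤x)

LShape-maxL : ∀ {t} → LShape t → maxL t ≡ hd t
LShape-maxL t⊢@(lshape {x} _ _ _ _) = maxL-∷-All≤ x _ (All.tail (LShape-All≤ t⊢))

UWord-maxL : ∀ {u m} → UWordWithRmin u m → maxL u ≡ hd u
UWord-maxL {m = m} (x , a , b , refl , a↓ , _ , b↑ , b<x) =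
  maxL-∷-All≤ x (a ++ m ∷ b) (All.++⁺ (All.tail (Nonincreasing⇒All≤ a↓))
                                     (All.map (λ c≤l → <⇒≤ (≤-<-trans c≤l b<x)) (Nondecreasing⇒All≤lastOf m b b↑)))

UWord-rmin-unique : ∀ {u m m'} → UWordWithRmin u m → UWordWithRmin u m' → m ≡ m'
UWord-rmin-unique u⊢ u⊢' = trans (sym (rmin-suffixHead u⊢)) (rmin-suffixHead u⊢')
  where
  rmin-suffixHead : ∀ {u m} → UWordWithRmin u m → hd (proj₂ (descentSplit u)) ≡ m
  rmin-suffixHead {m = m} (x , a , b , refl , a↓ , m<a , b↑ , _)
    rewrite descentSplit-descendingRun x a m b a↓ m<a (decAt-nondecreasing m b b↑) = refl

RminBelowMax : Word → Word → Set
RminBelowMax u u' = ∀ m → UWordWithRmin u m → m < maxL u'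

UChain⇔UWords : ∀ us → UChain us ⇔ (All UWord us × Linked RminBelowMax us)
UChain⇔UWords us = mk⇔ (from us) (λ (us⊢ , us↑) → to us us⊢ us↑)
  where
  to : ∀ us → All UWord us → Linked RminBelowMax us → UChain us
  to []            _                            _            = []
  to (u ∷ [])      ((_ , u⊢) ∷ _)               _            = cons u⊢ tt []
  to (u ∷ u' ∷ us) ((m , u⊢) ∷ us⊢@((_ , u'⊢) ∷ _)) (m<u' ∷ us↑) =
    cons u⊢ (subst (m <_) (UWord-maxL u'⊢) (m<u' m u⊢)) (to (u' ∷ us) us⊢ us↑)
  from : ∀ us → UChain us → All UWord us × Linked RminBelowMax us
  from []            []                 = [] , []
  from (u ∷ [])      (cons u⊢ _ [])     = (_ , u⊢) ∷ [] , [-]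
  from (u ∷ u' ∷ us) (cons u⊢ m<u' us⊢@(cons u'⊢ _ _)) =
    let (us-words , us↑) = from (u' ∷ us) us⊢ in
    (_ , u⊢) ∷ us-words ,
    (λ m' u⊢' → subst (_< maxL u') (UWord-rmin-unique u⊢ u⊢') (subst (_ <_) (sym (UWord-maxL u'⊢)) m<u')) ∷ us↑

Linked-mapWith-All : ∀ {P : Word → Set} {R R' : Word → Word → Set} {ws} →
  (∀ {w w'} → P w → P w' → R w w' → R' w w') → All P ws → Linked R ws → Linked R' ws
Linked-mapWith-All f _                    []        = []
Linked-mapWith-All f _                    [-]       = [-]
Linked-mapWith-All f (Pw ∷ Pws@(Pw' ∷ _)) (r ∷ rs) = f Pw Pw' r ∷ Linked-mapWith-All f Pws rs

MaxSorted : List Word → Set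
MaxSorted = Linked (λ l l' → maxL l ≤ maxL l')

LShapes⇔LWords : ∀ ls → (All LShape ls × HeadSorted ls) ⇔ (All LWord ls × MaxSorted ls)
LShapes⇔LWords ls = mk⇔
  (λ (ls⊢ , ls↑) → All.map LShape⇒LWord ls⊢ ,
     Linked-mapWith-All (λ l⊢ l'⊢ → subst₂ _≤_ (sym (LShape-maxL l⊢)) (sym (LShape-maxL l'⊢))) ls⊢ ls↑)
  (λ (ls-words , ls↑) → let ls⊢ = All.map LWord⇒LShape ls-words in
     ls⊢ , Linked-mapWith-All (λ l⊢ l'⊢ → subst₂ _≤_ (LShape-maxL l⊢) (LShape-maxL l'⊢)) ls⊢ ls↑)

sum-map-concat : ∀ (f : Word → ℕ) → f [] ≡ 0 → (∀ a b → f (a ++ b) ≡ f a + f b) →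
                 ∀ ws → sum (map f ws) ≡ f (concat ws)
sum-map-concat f f-[] f-++ []       = sym f-[]
sum-map-concat f f-[] f-++ (w ∷ ws) = trans (cong (f w +_) (sum-map-concat f f-[] f-++ ws)) (sym (f-++ w (concat ws)))

sum-map-length-↭ : ∀ A B → concat A ↭ concat B → sum (map length A) ≡ sum (map length B)
sum-map-length-↭ A B A↭B = trans (len A) (trans (↭-length A↭B) (sym (len B)))
  where len = sum-map-concat length refl (λ a _ → length-++ a)

sum-map-tot-↭ : ∀ A B → concat A ↭ concat B → sum (map tot A) ≡ sum (map tot B)
sum-map-tot-↭ A B A↭B = trans (tot≡ A) (trans (sum-↭ A↭B) (sym (tot≡ B)))
  where tot≡ = sum-map-concat tot refl sum-++

LettersLe-↭ : ∀ r A B → concat A ↭ concat B → All (LettersLe r) B → All (LettersLe r) A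
LettersLe-↭ r A B A↭B B≤r = All.concat⁻ (All-resp-↭ (↭-sym A↭B) (All.concat⁺ B≤r))

uToLSeq : Seq → Seq
uToLSeq (w₀ , us) = w₀ , uToL us

lToUSeq : Seq → Seq
lToUSeq (w₀ , ls) = w₀ , lToU (length (concat ls)) ls

InUStar⇒UChain : ∀ {n r w₀ us} → InUStar n r (w₀ , us) → UChain us
InUStar⇒UChain {us = us} (_ , us⊢ , _ , us↑) = Equivalence.from (UChain⇔UWords us) (All.map proj₁ us⊢ , us↑)

InLStar⇒LShapes : ∀ {n r w₀ ls} → InLStar n r (w₀ , ls) → All LShape ls × HeadSorted ls
InLStar⇒LShapes {ls = ls} (_ , ls⊢ , _ , ls↑) = Equivalence.from (LShapes⇔LWords ls) (All.map proj₁ ls⊢ , ls↑)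

uToLSeq-InLStar : ∀ {n r} s → InUStar n r s → InLStar n r (uToLSeq s)
uToLSeq-InLStar {r = r} (w₀ , us) s⊢@(w₀⊢ , us⊢ , len≡ , _) =
  let chain                   = InUStar⇒UChain s⊢
      ls↭us                   = uToL-↭ us chain
      (ls⊢ , ls↑ , _)         = uToL-valid us chain
      (ls-words , ls-maxSorted) = Equivalence.to (LShapes⇔LWords (uToL us)) (ls⊢ , ls↑)
  in w₀⊢ , All.zip (ls-words , LettersLe-↭ r (uToL us) us ls↭us (All.map proj₂ us⊢)) ,
     trans (cong (length w₀ +_) (sum-map-length-↭ (uToL us) us ls↭us)) len≡ , ls-maxSorted

lToUSeq-InUStar : ∀ {n r} t → InLStar n r t → InUStar n r (lToUSeq t)
lToUSeq-InUStar {r = r} (w₀ , ls) t⊢@(w₀⊢ , ls⊢ , len≡ , _) =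
  let k                    = length (concat ls)
      us                   = lToU k ls
      (shapes , sorted)    = InLStar⇒LShapes t⊢
      (chain , _)          = lToU-valid k ls shapes sorted ≤-refl
      us↭ls                = subst (λ L → concat us ↭ concat L) (uToL-lToU k ls shapes sorted ≤-refl)
                                   (↭-sym (uToL-↭ us chain))
      (us-words , us-rmin) = Equivalence.to (UChain⇔UWords us) chain
  in w₀⊢ , All.zip (us-words , LettersLe-↭ r us ls us↭ls (All.map proj₂ ls⊢)) ,
     trans (cong (length w₀ +_) (sum-map-length-↭ us ls us↭ls)) len≡ , us-rmin

lToUSeq-uToLSeq : ∀ {n r} s → InUStar n r s → lToUSeq (uToLSeq s) ≡ s
lToUSeq-uToLSeq (w₀ , us) s⊢ =
  cong (w₀ ,_) (lToU-uToL _ us chain (≤-reflexive (sym (↭-length (uToL-↭ us chain)))))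
  where chain = InUStar⇒UChain s⊢

uToLSeq-lToUSeq : ∀ {n r} t → InLStar n r t → uToLSeq (lToUSeq t) ≡ t
uToLSeq-lToUSeq (w₀ , ls) t⊢ = cong (w₀ ,_) (uToL-lToU _ ls (proj₁ shapes) (proj₂ shapes) ≤-refl)
  where shapes = InLStar⇒LShapes t⊢

uToLSeq-statistics : ∀ {n r} s → InUStar n r s →
    (proj₁ (uToLSeq s) ≡ proj₁ s) ×
    (concat (proj₂ (uToLSeq s)) ↭ concat (proj₂ s)) ×
    (sum (map tot (proj₂ (uToLSeq s))) ≡ sum (map tot (proj₂ s))) ×
    (sum (map dec (proj₂ (uToLSeq s))) ≡ sum (map dec (proj₂ s)))
uToLSeq-statistics (w₀ , us) s⊢ =
  refl , uToL-↭ us chain , sum-map-tot-↭ (uToL us) us (uToL-↭ us chain) , uToL-dec us chain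
  where chain = InUStar⇒UChain s⊢

proposition3p3 : (r n : ℕ) →
    Σ (Seq → Seq) λ f → Σ (Seq → Seq) λ g →
      (∀ s → InUStar n r s → InLStar n r (f s)) ×
      (∀ t → InLStar n r t → InUStar n r (g t)) ×
      (∀ s → InUStar n r s → g (f s) ≡ s) ×
      (∀ t → InLStar n r t → f (g t) ≡ t) ×
      (∀ s → InUStar n r s →
        (proj₁ (f s) ≡ proj₁ s) ×
        (concat (proj₂ (f s)) ↭ concat (proj₂ s)) ×
        (sum (map tot (proj₂ (f s))) ≡ sum (map tot (proj₂ s))) ×
        (sum (map dec (proj₂ (f s))) ≡ sum (map dec (proj₂ s))))
proposition3p3 r n =
  uToLSeq , lToUSeq ,
  uToLSeq-InLStar , lToUSeq-InUStar , lToUSeq-uToLSeq , uToLSeq-lToUSeq , uToLSeq-statistics
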